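{- Let $n=p_1^{n_1}\cdots p_r^{n_r}$ with $r\geq 3$, primes $p_1<\cdots<p_r$ and positive integers $n_i$. Let $a,b\in[r]$ with $a<b$ and $2\phi\left(\frac{p_1\cdots p_r}{p_a}\right)<\frac{p_1\cdots p_r}{p_a}$. Then: (i) If $n_b\geq 3$ and $p_b^2(p_b-p_a)+2\phi(p_a)\geq (r-1)p_a$, then $\beta_a^{n_a}>\beta_b^{n_b}$. (ii) If $n_b=2$ and $p_b(p_b-p_a)+2\phi(p_a)\geq (r-1)p_a$, then $\beta_a^{n_a}>\beta_b^{n_b}$.
   Context: $[m]=\{1,\dots,m\}$, $\phi$ is Euler's totient function. For $a\in[r]$ and $s\in[n_a]$, $$\beta_a^s:=\phi(n)+\frac{n}{p_1\cdots p_r}\cdot\frac{1}{p_a^{s-1}}\left[\frac{p_1\cdots p_r}{p_a}+\phi\left(\frac{p_1\cdots p_r}{p_a}\right)(p_a^{s-1}-2)\right].$$ -}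

module Defs where

open import Data.Nat as ℕ using (ℕ; zero; suc; _*_; _^_; _∸_)
open import Data.Nat.Properties using (_≟_)
import Data.Nat.DivMod as ℕD
open import Data.Nat.GCD using (gcd)
open import Data.Fin using (Fin)
import Data.Fin as Fin
open import Data.List using (List; length; filter; map; upTo)
open import Data.Integer as ℤ using (ℤ; +_)
open import Data.Rational as ℚ using (ℚ)

φ : ℕ → ℕ
φ m = length (filter (λ k → gcd k m ≟ 1) (map suc (upTo m)))

∏ : ∀ {r} → (Fin r → ℕ) → ℕ
∏ {zero}  f = 1
∏ {suc r} f = f Fin.zero * ∏ (λ i → f (Fin.suc i))

-- natural division (exact in all uses below; divisor 0 never occurs for primes)
_div_ : ℕ → ℕ → ℕ
m div zero    = 0
m div (suc d) = ℕD._/_ m (suc d)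

-- rational division of an integer by a natural (divisor 0 never occurs for primes)
_/ℚ_ : ℤ → ℕ → ℚ
i /ℚ zero    = ℚ.0ℚ
i /ℚ (suc d) = i ℚ./ suc d

ℕ→ℚ : ℕ → ℚ
ℕ→ℚ m = (+ m) /ℚ 1

nOf : ∀ {r} → (Fin r → ℕ) → (Fin r → ℕ) → ℕ
nOf p e = ∏ (λ i → p i ^ e i)

β : ∀ {r} → (Fin r → ℕ) → (Fin r → ℕ) → Fin r → ℕ → ℚ
β p e a s =
  ℕ→ℚ (φ n) ℚ.+
    ((+ n) /ℚ (P * p a ^ (s ∸ 1))) ℚ.*
      (ℕ→ℚ (P div p a) ℚ.+ ℕ→ℚ (φ (P div p a)) ℚ.* (ℕ→ℚ (p a ^ (s ∸ 1)) ℚ.- ℕ→ℚ 2))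
  where
    n = nOf p e
    P = ∏ p

-- Write P = p₁⋯p_r = p_a p_b R and T_x = p_x^(n_x − 1). Since φ(qm) = (q − 1) φ(m) for a prime q ∤ m,
-- φ(P/p_a) = (p_b − 1) φ(R) and φ(P/p_b) = (p_a − 1) φ(R); moreover R ≤ (r − 1) φ(R), because the
-- i-th smallest of the r − 2 primes dividing R is at least i + 1. Up to the common terms φ(n) and n/P,
-- β_x^{n_x} is the fraction B_x / T_x with B_x = P/p_x + φ(P/p_x)(T_x − 2), and φ(P/p_a) separates the two:
-- B_b/T_b ≤ φ(P/p_a) by the bound on R and the hypothesis on p_b, while φ(P/p_a) < B_a/T_a is exactly
-- the hypothesis 2φ(P/p_a) < P/p_a.
module Submission where

open import Defs
open import Data.Nat using (ℕ; zero; suc; _*_; _+_; _∸_; _^_; _≤_; _<_; s≤s; z≤n)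
open import Data.Nat using (NonZero; >-nonZero⁻¹; nonTrivial⇒n>1; nonTrivial⇒≢1; nonTrivial⇒nonZero)
import Data.Nat.Properties as ℕ
import Data.Nat.DivMod as ℕ
import Data.Nat.Tactic.RingSolver as ℕ-Solver
open import Data.Nat.Divisibility
  using (_∣_; _∣?_; ∣⇒≤; ∣-refl; ∣-trans; n∣m*n; m∣m*n; ∣m+n∣m⇒∣n; ∣m∣n⇒∣m+n; ∣1⇒≡1)
open import Data.Nat.Coprimality as Coprime
  using (Coprime; coprime?; coprime-divisor; coprime⇒gcd≡1; gcd≡1⇒coprime)
open import Data.Nat.GCD using (gcd)
open import Data.Nat.Primality using (Prime; euclidsLemma; prime⇒irreducible; prime⇒nonZero; prime⇒nonTrivial)
open import Data.Integer as ℤ using (ℤ; +_; +≤+; +<+)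
import Data.Integer.Properties as ℤ
import Data.Integer.Tactic.RingSolver as ℤ-Solver
open import Data.Rational using (ℚ; toℚᵘ)
import Data.Rational as ℚ
import Data.Rational.Properties as ℚ
open import Data.Rational.Unnormalised as ℚᵘ using (mkℚᵘ; *≡*; *<*; _≃_)
import Data.Rational.Unnormalised.Properties as ℚᵘ
open import Data.Fin using (Fin; punchIn; punchOut)
import Data.Fin as Fin
import Data.Fin.Properties as Fin
open import Data.List using ([]; _∷_; _++_; length; filter; applyUpTo)
open import Data.List.Properties using (filter-++; length-++; filter-none; applyUpTo-∷ʳ; map-upTo)
open import Data.List.Relation.Unary.All.Properties using (applyUpTo⁺₁)
open import Data.Product using (_×_; _,_; proj₁; proj₂)
open import Data.Sum using (inj₁; inj₂)
open import Function using (id; _∘_; _⇔_; Equivalence; mk⇔)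
open import Level using (Level)
open import Relation.Nullary using (¬_; yes; no; contradiction)
open import Relation.Unary using (Pred; Decidable)
open import Relation.Unary.Properties using (_∩?_; ∁?)
open import Relation.Binary.Definitions using (tri<; tri≈; tri>)
open import Relation.Binary.PropositionalEquality
open import Algebra.Properties.CommutativeSemigroup ℕ.*-commutativeSemigroup
  using (x∙yz≈y∙xz; xy∙z≈y∙xz; xy∙z≈xz∙y; x∙yz≈yx∙z)

private variable
  ℓ ℓ′ : Level
  P : Pred ℕ ℓ

-- Counting in intervals

count : Decidable P → (ℕ → ℕ) → ℕ → ℕ
count P? f n = length (filter P? (applyUpTo f n))

applyUpTo-+ : ∀ {A : Set} (f : ℕ → A) m n →
  applyUpTo f (m + n) ≡ applyUpTo f m ++ applyUpTo (λ i → f (m + i)) n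
applyUpTo-+ f zero    n = refl
applyUpTo-+ f (suc m) n = cong (f 0 ∷_) (applyUpTo-+ (f ∘ suc) m n)

count-+ : ∀ (P? : Decidable P) (f : ℕ → ℕ) m n →
  count P? f (m + n) ≡ count P? f m + count P? (λ i → f (m + i)) n
count-+ P? f m n = begin
  length (filter P? (applyUpTo f (m + n)))
    ≡⟨ cong (length ∘ filter P?) (applyUpTo-+ f m n) ⟩
  length (filter P? (applyUpTo f m ++ applyUpTo (λ i → f (m + i)) n))
    ≡⟨ cong length (filter-++ P? (applyUpTo f m) _) ⟩
  length (filter P? (applyUpTo f m) ++ filter P? (applyUpTo (λ i → f (m + i)) n))
    ≡⟨ length-++ (filter P? (applyUpTo f m)) ⟩
  count P? f m + count P? (λ i → f (m + i)) n ∎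
  where open ≡-Reasoning

count-cong : ∀ {P : Pred ℕ ℓ} {Q : Pred ℕ ℓ′} (P? : Decidable P) (Q? : Decidable Q) {f g : ℕ → ℕ} →
  (∀ i → P (f i) ⇔ Q (g i)) → ∀ n → count P? f n ≡ count Q? g n
count-cong P? Q? P⇔Q zero = refl
count-cong P? Q? {f} {g} P⇔Q (suc n) with P? (f 0) | Q? (g 0)
... | yes _  | yes _  = cong suc (count-cong P? Q? (P⇔Q ∘ suc) n)
... | no _   | no _   = count-cong P? Q? (P⇔Q ∘ suc) n
... | yes p  | no ¬q  = contradiction (Equivalence.to (P⇔Q 0) p) ¬q
... | no ¬p  | yes q  = contradiction (Equivalence.from (P⇔Q 0) q) ¬p

count-split : ∀ {P : Pred ℕ ℓ} {Q : Pred ℕ ℓ′} (P? : Decidable P) (Q? : Decidable Q) f n →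
  count P? f n ≡ count (P? ∩? Q?) f n + count (P? ∩? ∁? Q?) f n
count-split P? Q? f zero = refl
count-split P? Q? f (suc n) with P? (f 0) | Q? (f 0)
... | yes _ | yes _ = cong suc (count-split P? Q? (f ∘ suc) n)
... | yes _ | no _  = trans (cong suc (count-split P? Q? (f ∘ suc) n)) (sym (ℕ.+-suc _ _))
... | no _  | _     = count-split P? Q? (f ∘ suc) n

count-none : ∀ (P? : Decidable P) f n → (∀ {i} → i < n → ¬ P (f i)) → count P? f n ≡ 0
count-none P? f n ¬P = cong length (filter-none P? (applyUpTo⁺₁ f n ¬P))

count-∷ʳ : ∀ (P? : Decidable P) f n → count P? f (suc n) ≡ count P? f n + count P? (λ _ → f n) 1
count-∷ʳ P? f n = begin
  length (filter P? (applyUpTo f (suc n)))      ≡⟨ cong (length ∘ filter P?) (applyUpTo-∷ʳ f n) ⟨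
  length (filter P? (applyUpTo f n ++ f n ∷ [])) ≡⟨ cong length (filter-++ P? (applyUpTo f n) _) ⟩
  length (filter P? (applyUpTo f n) ++ filter P? (f n ∷ [])) ≡⟨ length-++ (filter P? (applyUpTo f n)) ⟩
  count P? f n + count P? (λ _ → f n) 1 ∎
  where open ≡-Reasoning

count-periodic : ∀ (P? : Decidable P) f m → (∀ i → P (f (m + i)) ⇔ P (f i)) →
  ∀ q → count P? f (q * m) ≡ q * count P? f m
count-periodic P? f m period zero = refl
count-periodic P? f m period (suc q) = begin
  count P? f (m + q * m)                             ≡⟨ count-+ P? f m (q * m) ⟩
  count P? f m + count P? (λ i → f (m + i)) (q * m)  ≡⟨ cong (_+_ (count P? f m)) (count-cong P? P? period (q * m)) ⟩
  count P? f m + count P? f (q * m)                  ≡⟨ cong (_+_ (count P? f m)) (count-periodic P? f m period q) ⟩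
  count P? f m + q * count P? f m ∎
  where open ≡-Reasoning

count-last-multiple : ∀ {P : Pred ℕ ℓ} (P? : Decidable P) q .{{_ : NonZero q}} →
  count (P? ∩? (q ∣?_)) suc q ≡ count P? (λ _ → q * 1) 1
count-last-multiple {P = P} P? (suc q) = begin
  count P∣? suc (suc q)
    ≡⟨ count-∷ʳ P∣? suc q ⟩
  count P∣? suc q + count P∣? (λ _ → suc q) 1
    ≡⟨ cong₂ _+_ (count-none P∣? suc q none-below) (count-cong P∣? P? last 1) ⟩
  count P? (λ _ → suc q * 1) 1 ∎
  where
  open ≡-Reasoning
  P∣? = P? ∩? (suc q ∣?_)
  none-below : ∀ {i} → i < q → ¬ (P (suc i) × suc q ∣ suc i)
  none-below i<q = ℕ.<⇒≱ (s≤s i<q) ∘ ∣⇒≤ ∘ proj₂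
  last : ∀ i → (P (suc q) × suc q ∣ suc q) ⇔ P (suc q * 1)
  last _ = mk⇔ (subst P (sym (ℕ.*-identityʳ (suc q))) ∘ proj₁)
               (λ p → subst P (ℕ.*-identityʳ (suc q)) p , ∣-refl)

count-multiples : ∀ {P : Pred ℕ ℓ} (P? : Decidable P) q .{{_ : NonZero q}} m →
  count (P? ∩? (q ∣?_)) suc (m * q) ≡ count P? (λ j → q * suc j) m
count-multiples P? q zero = refl
count-multiples {P = P} P? q (suc m) = begin
  count (P? ∩? (q ∣?_)) suc (q + m * q)
    ≡⟨ count-+ (P? ∩? (q ∣?_)) suc q (m * q) ⟩
  count (P? ∩? (q ∣?_)) suc q + count (P? ∩? (q ∣?_)) (λ i → suc (q + i)) (m * q)
    ≡⟨ cong₂ _+_ (count-last-multiple P? q) (count-cong (P? ∩? (q ∣?_)) (Pq+? ∩? (q ∣?_)) shift (m * q)) ⟩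
  first + count (Pq+? ∩? (q ∣?_)) suc (m * q)
    ≡⟨ cong (_+_ first) (count-multiples Pq+? q m) ⟩
  first + count Pq+? (λ j → q * suc j) m
    ≡⟨ cong (_+_ first) (count-cong Pq+? P? next m) ⟩
  first + count P? (λ j → q * suc (suc j)) m
    ≡⟨ count-+ P? (λ j → q * suc j) 1 m ⟨
  count P? (λ j → q * suc j) (suc m) ∎
  where
  open ≡-Reasoning
  first = count P? (λ _ → q * 1) 1
  Pq+? = λ k → P? (q + k)
  shift : ∀ i → (P (suc (q + i)) × q ∣ suc (q + i)) ⇔ (P (q + suc i) × q ∣ suc i)
  shift i rewrite sym (ℕ.+-suc q i) =
    mk⇔ (λ (p , d) → p , ∣m+n∣m⇒∣n d ∣-refl) (λ (p , d) → p , ∣m∣n⇒∣m+n ∣-refl d)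
  next : ∀ j → P (q + q * suc j) ⇔ P (q * suc (suc j))
  next j rewrite ℕ.*-suc q (suc j) = mk⇔ id id

-- Euler's totient

coprime-+⁻¹ : ∀ {m n} → Coprime (n + m) n → Coprime m n
coprime-+⁻¹ c (d∣m , d∣n) = c (∣m∣n⇒∣m+n d∣n d∣m , d∣n)

coprime-∣ˡ : ∀ {d m n} → d ∣ m → Coprime m n → Coprime d n
coprime-∣ˡ d∣m c (e∣d , e∣n) = c (∣-trans e∣d d∣m , e∣n)

coprime-*ˡ : ∀ {a b n} → Coprime a n → Coprime b n → Coprime (a * b) n
coprime-*ˡ ca cb (d∣ab , d∣n) = cb (coprime-divisor (coprime-∣ˡ d∣n (Coprime.sym ca)) d∣ab , d∣n)

prime∤⇒coprime : ∀ {p n} → Prime p → ¬ p ∣ n → Coprime p n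
prime∤⇒coprime pp p∤n (d∣p , d∣n) with prime⇒irreducible pp d∣p
... | inj₁ d≡1 = d≡1
... | inj₂ refl = contradiction d∣n p∤n

prime⇒≢1 : ∀ {p} → Prime p → p ≢ 1
prime⇒≢1 pp = nonTrivial⇒≢1 {{prime⇒nonTrivial pp}}

φ≡count : ∀ m → φ m ≡ count (λ k → coprime? k m) suc m
φ≡count m = trans (cong (length ∘ filter (λ k → gcd k m ℕ.≟ 1)) (map-upTo suc m))
                  (count-cong (λ k → gcd k m ℕ.≟ 1) (λ k → coprime? k m) (λ _ → mk⇔ gcd≡1⇒coprime coprime⇒gcd≡1) m)

-- Of the p·φ(m) integers in (0, pm] coprime to m, φ(m) are multiples of p and the rest are coprime to pm.
φ-*-prime : ∀ {p} m → Prime p → ¬ p ∣ m → φ (p * m) ≡ (p ∸ 1) * φ m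
φ-*-prime {p} m pp p∤m = begin
  φ (p * m)                ≡⟨ ℕ.m+n∸m≡n (φ m) (φ (p * m)) ⟨
  φ m + φ (p * m) ∸ φ m    ≡⟨ cong (_∸ φ m) partition ⟨
  p * φ m ∸ φ m            ≡⟨ cong (p * φ m ∸_) (ℕ.*-identityˡ (φ m)) ⟨
  p * φ m ∸ 1 * φ m        ≡⟨ ℕ.*-distribʳ-∸ (φ m) p 1 ⟨
  (p ∸ 1) * φ m ∎
  where
  open ≡-Reasoning
  instance _ = nonTrivial⇒nonZero p {{prime⇒nonTrivial pp}}
  C? = λ k → coprime? k m
  D? = p ∣?_

  coprime-*-prime⇔ : ∀ {k} → (Coprime k m × ¬ p ∣ k) ⇔ Coprime k (p * m)
  coprime-*-prime⇔ {k} = mk⇔ from to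
    where
    to : Coprime k (p * m) → Coprime k m × ¬ p ∣ k
    to c = Coprime.sym (coprime-∣ˡ (n∣m*n p) (Coprime.sym c)) , λ p∣k → prime⇒≢1 pp (c (p∣k , m∣m*n m))
    from : Coprime k m × ¬ p ∣ k → Coprime k (p * m)
    from (c , p∤k) = Coprime.sym (coprime-*ˡ (prime∤⇒coprime pp p∤k) (Coprime.sym c))

  coprimes-in-p-periods : count C? suc (p * m) ≡ p * φ m
  coprimes-in-p-periods = begin
    count C? suc (p * m)  ≡⟨ count-periodic C? suc m period p ⟩
    p * count C? suc m    ≡⟨ cong (p *_) (φ≡count m) ⟨
    p * φ m ∎
    where
    period : ∀ i → Coprime (suc (m + i)) m ⇔ Coprime (suc i) m
    period i rewrite sym (ℕ.+-suc m i) = mk⇔ coprime-+⁻¹ Coprime.coprime-+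

  coprime-multiples : count (C? ∩? D?) suc (p * m) ≡ φ m
  coprime-multiples = begin
    count (C? ∩? D?) suc (p * m)  ≡⟨ cong (count (C? ∩? D?) suc) (ℕ.*-comm p m) ⟩
    count (C? ∩? D?) suc (m * p)  ≡⟨ count-multiples C? p m ⟩
    count C? (λ j → p * suc j) m  ≡⟨ count-cong C? C? (λ _ → coprime-p*⇔) m ⟩
    count C? suc m                ≡⟨ φ≡count m ⟨
    φ m ∎
    where
    coprime-p*⇔ : ∀ {j} → Coprime (p * j) m ⇔ Coprime j m
    coprime-p*⇔ = mk⇔ (coprime-∣ˡ (n∣m*n p)) (coprime-*ˡ (prime∤⇒coprime pp p∤m))

  coprime-non-multiples : count (C? ∩? ∁? D?) suc (p * m) ≡ φ (p * m)
  coprime-non-multiples = begin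
    count (C? ∩? ∁? D?) suc (p * m)
      ≡⟨ count-cong (C? ∩? ∁? D?) (λ k → coprime? k (p * m)) (λ _ → coprime-*-prime⇔) (p * m) ⟩
    count (λ k → coprime? k (p * m)) suc (p * m)
      ≡⟨ φ≡count (p * m) ⟨
    φ (p * m) ∎

  partition : p * φ m ≡ φ m + φ (p * m)
  partition = begin
    p * φ m
      ≡⟨ coprimes-in-p-periods ⟨
    count C? suc (p * m)
      ≡⟨ count-split C? D? suc (p * m) ⟩
    count (C? ∩? D?) suc (p * m) + count (C? ∩? ∁? D?) suc (p * m)
      ≡⟨ cong₂ _+_ coprime-multiples coprime-non-multiples ⟩
    φ m + φ (p * m) ∎

φ-prime : ∀ {p} → Prime p → φ p ≡ p ∸ 1
φ-prime {p} pp = begin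
  φ p             ≡⟨ cong φ (ℕ.*-identityʳ p) ⟨
  φ (p * 1)       ≡⟨ φ-*-prime 1 pp (prime⇒≢1 pp ∘ ∣1⇒≡1) ⟩
  (p ∸ 1) * 1     ≡⟨ ℕ.*-identityʳ (p ∸ 1) ⟩
  p ∸ 1 ∎
  where open ≡-Reasoning

-- Products of increasing primes

StrictlyIncreasing : ∀ {r} → (Fin r → ℕ) → Set
StrictlyIncreasing p = ∀ i j → i Fin.< j → p i < p j

∏-nonZero : ∀ {r} (f : Fin r → ℕ) → (∀ i → NonZero (f i)) → NonZero (∏ f)
∏-nonZero {zero}  f f≢0 = _
∏-nonZero {suc r} f f≢0 =
  ℕ.m*n≢0 (f Fin.zero) (∏ (f ∘ Fin.suc)) {{f≢0 Fin.zero}} {{∏-nonZero (f ∘ Fin.suc) (f≢0 ∘ Fin.suc)}}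

∏-punchIn : ∀ {r} (f : Fin (suc r) → ℕ) i → ∏ f ≡ f i * ∏ (f ∘ punchIn i)
∏-punchIn f Fin.zero = refl
∏-punchIn {suc r} f (Fin.suc i) =
  trans (cong (f Fin.zero *_) (∏-punchIn (f ∘ Fin.suc) i)) (x∙yz≈y∙xz (f Fin.zero) (f (Fin.suc i)) _)

prime∤∏ : ∀ {r x} (q : Fin r → ℕ) → Prime x → (∀ i → Prime (q i)) → (∀ i → q i ≢ x) → ¬ x ∣ ∏ q
prime∤∏ {zero}  q px pq q≢x x∣1 = prime⇒≢1 px (∣1⇒≡1 x∣1)
prime∤∏ {suc r} q px pq q≢x x∣∏ with euclidsLemma (q Fin.zero) (∏ (q ∘ Fin.suc)) px x∣∏
... | inj₂ x∣tail = prime∤∏ (q ∘ Fin.suc) px (pq ∘ Fin.suc) (q≢x ∘ Fin.suc) x∣tail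
... | inj₁ x∣q₀ with prime⇒irreducible (pq Fin.zero) x∣q₀
...   | inj₁ x≡1  = prime⇒≢1 px x≡1
...   | inj₂ x≡q₀ = q≢x Fin.zero (sym x≡q₀)

strictlyIncreasing⇒≢ : ∀ {r} {p : Fin r → ℕ} → StrictlyIncreasing p → ∀ {i j} → i ≢ j → p i ≢ p j
strictlyIncreasing⇒≢ incr {i} {j} i≢j with Fin.<-cmp i j
... | tri< i<j _ _ = ℕ.<⇒≢ (incr i j i<j)
... | tri≈ _ i≡j _ = contradiction i≡j i≢j
... | tri> _ _ j<i = ℕ.<⇒≢ (incr j i j<i) ∘ sym

punchIn-mono-< : ∀ {r} (i : Fin (suc r)) {j k} → j Fin.< k → punchIn i j Fin.< punchIn i k
punchIn-mono-< i {j} {k} j<k = ℕ.≰⇒> (ℕ.<⇒≱ j<k ∘ Fin.punchIn-cancel-≤ i k j)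

strictlyIncreasing-punchIn : ∀ {r} {p : Fin (suc r) → ℕ} i →
  StrictlyIncreasing p → StrictlyIncreasing (p ∘ punchIn i)
strictlyIncreasing-punchIn i incr j k j<k = incr _ _ (punchIn-mono-< i j<k)

[1+s]*n≤[2+s]*[n∸1] : ∀ s n → 2 + s ≤ n → suc s * n ≤ (2 + s) * (n ∸ 1)
[1+s]*n≤[2+s]*[n∸1] s (suc c) (s≤s s<c) = begin
  suc s * suc c      ≡⟨ ℕ.*-suc (suc s) c ⟩
  suc s + suc s * c  ≤⟨ ℕ.+-monoˡ-≤ (suc s * c) s<c ⟩
  c + suc s * c      ≡⟨⟩
  (2 + s) * c ∎
  where open ℕ.≤-Reasoning

-- Monotonicity gives q i ≥ s + 2 + i, so
-- φ(∏ q)/∏ q = ∏ (1 − 1/q i) ≥ ∏_{i<k} (s + 1 + i)/(s + 2 + i) = (s + 1)/(s + 1 + k).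
φ-∏-lowerBound : ∀ {k} (q : Fin k → ℕ) s → (∀ i → Prime (q i)) → StrictlyIncreasing q →
  (∀ i → 2 + s ≤ q i) → suc s * ∏ q ≤ (suc s + k) * φ (∏ q)
φ-∏-lowerBound {zero} q s _ _ _ = ℕ.≤-reflexive (cong (_* 1) (sym (ℕ.+-identityʳ (suc s))))
φ-∏-lowerBound {suc k} q s pq incr q≥2+s = begin
  suc s * (q₀ * m)                     ≡⟨ ℕ.*-assoc (suc s) q₀ m ⟨
  suc s * q₀ * m                       ≤⟨ ℕ.*-monoˡ-≤ m ([1+s]*n≤[2+s]*[n∸1] s q₀ (q≥2+s Fin.zero)) ⟩
  (2 + s) * (q₀ ∸ 1) * m               ≡⟨ xy∙z≈y∙xz (2 + s) (q₀ ∸ 1) m ⟩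
  (q₀ ∸ 1) * ((2 + s) * m)             ≤⟨ ℕ.*-monoʳ-≤ (q₀ ∸ 1) tail-bound ⟩
  (q₀ ∸ 1) * ((2 + s + k) * φ m)       ≡⟨ x∙yz≈y∙xz (q₀ ∸ 1) (2 + s + k) (φ m) ⟩
  (2 + s + k) * ((q₀ ∸ 1) * φ m)       ≡⟨ cong₂ _*_ (sym (ℕ.+-suc (suc s) k)) (sym (φ-*-prime m (pq Fin.zero) q₀∤m)) ⟩
  (suc s + suc k) * φ (q₀ * m) ∎
  where
  open ℕ.≤-Reasoning
  q₀ = q Fin.zero
  m = ∏ (q ∘ Fin.suc)
  q₀<tail : ∀ i → q₀ < q (Fin.suc i)
  q₀<tail i = incr Fin.zero (Fin.suc i) (s≤s z≤n)
  q₀∤m : ¬ q₀ ∣ m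
  q₀∤m = prime∤∏ (q ∘ Fin.suc) (pq Fin.zero) (pq ∘ Fin.suc) (λ i → ℕ.>⇒≢ (q₀<tail i))
  tail-bound : (2 + s) * m ≤ (2 + s + k) * φ m
  tail-bound = φ-∏-lowerBound (q ∘ Fin.suc) (suc s) (pq ∘ Fin.suc) (λ i j i<j → incr _ _ (s≤s i<j))
                 (λ i → ℕ.≤-<-trans (q≥2+s Fin.zero) (q₀<tail i))

*-div-cancelˡ : ∀ m n .{{_ : NonZero m}} → (m * n) div m ≡ n
*-div-cancelˡ (suc d) n = trans (cong (ℕ._/ suc d) (ℕ.*-comm (suc d) n)) (ℕ.m*n/n≡m n (suc d))

-- The brackets of β

-- Q_b + F_b T_b ≤ F_a T_b + 2 F_b for Q_b = p_a R, F_b = (p_a − 1) F, F_a = (p_b − 1) F.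
b-bracket-bound : ∀ {k R F pa pb Tb} → 1 ≤ pa → pa ≤ pb → R ≤ k * F →
  k * pa ≤ Tb * (pb ∸ pa) + 2 * (pa ∸ 1) →
  pa * R + (pa ∸ 1) * F * Tb ≤ (pb ∸ 1) * F * Tb + 2 * ((pa ∸ 1) * F)
b-bracket-bound {k} {R} {F} {suc c} {pb} {Tb} _ pa≤pb R≤kF kpa≤ = begin
  suc c * R + c * F * Tb             ≤⟨ ℕ.+-monoˡ-≤ (c * F * Tb) (ℕ.*-monoʳ-≤ (suc c) R≤kF) ⟩
  suc c * (k * F) + c * F * Tb       ≡⟨ cong (_+ c * F * Tb) (x∙yz≈yx∙z (suc c) k F) ⟩
  k * suc c * F + c * F * Tb         ≤⟨ ℕ.+-monoˡ-≤ (c * F * Tb) (ℕ.*-monoˡ-≤ F kpa≤) ⟩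
  (Tb * w + 2 * c) * F + c * F * Tb  ≡⟨ regroup Tb w c F ⟩
  (w + c) * F * Tb + 2 * (c * F)     ≡⟨ cong (λ x → x * F * Tb + 2 * (c * F)) pb∸1≡w+c ⟨
  (pb ∸ 1) * F * Tb + 2 * (c * F) ∎
  where
  open ℕ.≤-Reasoning
  w = pb ∸ suc c
  pb∸1≡w+c : pb ∸ 1 ≡ w + c
  pb∸1≡w+c = trans (cong (_∸ 1) (sym (ℕ.m∸n+n≡m pa≤pb))) (ℕ.+-∸-assoc w (s≤s z≤n))
  regroup : ∀ Tb w c F → (Tb * w + 2 * c) * F + c * F * Tb ≡ (w + c) * F * Tb + 2 * (c * F)
  regroup = ℕ-Solver.solve-∀

-- The bracket P/p_x + φ(P/p_x)(T − 2) of β, for Q = P/p_x and F = φ(Q).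
bracket : (Q F T : ℕ) → ℤ
bracket Q F T = + Q ℤ.+ + F ℤ.* (+ T ℤ.- + 2)

bracket≡[Q+FT]-2F : ∀ Q F T → bracket Q F T ≡ + (Q + F * T) ℤ.- + (2 * F)
bracket≡[Q+FT]-2F Q F T = begin
  bracket Q F T                          ≡⟨ regroup (+ Q) (+ F) (+ T) ⟩
  (+ Q ℤ.+ + F ℤ.* + T) ℤ.- + 2 ℤ.* + F  ≡⟨ cong₂ ℤ._-_ (sym cast) (sym (ℤ.pos-* 2 F)) ⟩
  + (Q + F * T) ℤ.- + (2 * F) ∎
  where
  open ≡-Reasoning
  regroup : ∀ q f t → q ℤ.+ f ℤ.* (t ℤ.- + 2) ≡ (q ℤ.+ f ℤ.* t) ℤ.- + 2 ℤ.* f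
  regroup = ℤ-Solver.solve-∀
  cast : + (Q + F * T) ≡ + Q ℤ.+ + F ℤ.* + T
  cast = trans (ℤ.pos-+ Q (F * T)) (cong (ℤ._+_ (+ Q)) (ℤ.pos-* F T))

pos-+-cancelʳ : ∀ m n → + (m + n) ℤ.- + n ≡ + m
pos-+-cancelʳ m n = trans (cong (ℤ._- + n) (ℤ.pos-+ m n)) (cancel (+ m) (+ n))
  where
  cancel : ∀ x y → x ℤ.+ y ℤ.- y ≡ x
  cancel = ℤ-Solver.solve-∀

bracket-≤ : ∀ {Q F T G} → Q + F * T ≤ G * T + 2 * F → bracket Q F T ℤ.≤ + (G * T)
bracket-≤ {Q} {F} {T} {G} h = begin
  bracket Q F T                   ≡⟨ bracket≡[Q+FT]-2F Q F T ⟩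
  + (Q + F * T) ℤ.- + (2 * F)     ≤⟨ ℤ.+-monoˡ-≤ (ℤ.- + (2 * F)) (+≤+ h) ⟩
  + (G * T + 2 * F) ℤ.- + (2 * F) ≡⟨ pos-+-cancelʳ (G * T) (2 * F) ⟩
  + (G * T) ∎
  where open ℤ.≤-Reasoning

bracket-> : ∀ {Q F} T → 2 * F < Q → + (F * T) ℤ.< bracket Q F T
bracket-> {Q} {F} T h = begin-strict
  + (F * T)                       ≡⟨ pos-+-cancelʳ (F * T) (2 * F) ⟨
  + (F * T + 2 * F) ℤ.- + (2 * F) <⟨ ℤ.+-monoˡ-< (ℤ.- + (2 * F)) (+<+ (ℕ.+-monoʳ-< (F * T) h)) ⟩
  + (F * T + Q) ℤ.- + (2 * F)     ≡⟨ cong (λ x → + x ℤ.- + (2 * F)) (ℕ.+-comm (F * T) Q) ⟩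
  + (Q + F * T) ℤ.- + (2 * F)     ≡⟨ bracket≡[Q+FT]-2F Q F T ⟨
  bracket Q F T ∎
  where open ℤ.≤-Reasoning

pos-*-swap : ∀ m n o → + (m * n) ℤ.* + o ≡ + (m * o) ℤ.* + n
pos-*-swap m n o = begin
  + (m * n) ℤ.* + o  ≡⟨ ℤ.pos-* (m * n) o ⟨
  + (m * n * o)      ≡⟨ cong +_ (xy∙z≈xz∙y m n o) ⟩
  + (m * o * n)      ≡⟨ ℤ.pos-* (m * o) n ⟩
  + (m * o) ℤ.* + n ∎
  where open ≡-Reasoning

bracket-cross-< : ∀ {Qa Qb Fa Fb Ta} Tb → .{{NonZero Tb}} → Qb + Fb * Tb ≤ Fa * Tb + 2 * Fb → 2 * Fa < Qa →
  bracket Qb Fb Tb ℤ.* + Ta ℤ.< bracket Qa Fa Ta ℤ.* + Tb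
bracket-cross-< {Qa} {Qb} {Fa} {Fb} {Ta} Tb@(suc _) b-side a-side = begin-strict
  bracket Qb Fb Tb ℤ.* + Ta   ≤⟨ ℤ.*-monoʳ-≤-nonNeg (+ Ta) (bracket-≤ {Qb} {Fb} {Tb} {Fa} b-side) ⟩
  + (Fa * Tb) ℤ.* + Ta        ≡⟨ pos-*-swap Fa Tb Ta ⟩
  + (Fa * Ta) ℤ.* + Tb        <⟨ ℤ.*-monoʳ-<-pos (+ Tb) (bracket-> {Qa} {Fa} Ta a-side) ⟩
  bracket Qa Fa Ta ℤ.* + Tb ∎
  where
  open ℤ.≤-Reasoning

-- β p e x s unfolds to βform (φ n) n (P * T) Q F T.
βform : (N n D Q F T : ℕ) → ℚ
βform N n D Q F T = ℕ→ℚ N ℚ.+ ((+ n) /ℚ D) ℚ.* (ℕ→ℚ Q ℚ.+ ℕ→ℚ F ℚ.* (ℕ→ℚ T ℚ.- ℕ→ℚ 2))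

toℚᵘ-/ℚ : ∀ i d → toℚᵘ (i /ℚ suc d) ≃ mkℚᵘ i d
toℚᵘ-/ℚ i d = ℚ.toℚᵘ-fromℚᵘ (mkℚᵘ i d)

toℚᵘ-bracket : ∀ Q F T →
  toℚᵘ (ℕ→ℚ Q ℚ.+ ℕ→ℚ F ℚ.* (ℕ→ℚ T ℚ.- ℕ→ℚ 2)) ≃ mkℚᵘ (bracket Q F T) 0
toℚᵘ-bracket Q F T = begin
  toℚᵘ (ℕ→ℚ Q ℚ.+ ℕ→ℚ F ℚ.* (ℕ→ℚ T ℚ.- ℕ→ℚ 2))
    ≈⟨ ℚᵘ.≃-trans (ℚ.toℚᵘ-homo-+ (ℕ→ℚ Q) _) (ℚᵘ.+-congʳ (toℚᵘ (ℕ→ℚ Q))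
         (ℚᵘ.≃-trans (ℚ.toℚᵘ-homo-* (ℕ→ℚ F) _) (ℚᵘ.*-congˡ {toℚᵘ (ℕ→ℚ F)}
           (ℚᵘ.≃-trans (ℚ.toℚᵘ-homo-+ (ℕ→ℚ T) _) (ℚᵘ.+-congʳ (toℚᵘ (ℕ→ℚ T)) (ℚ.toℚᵘ-homo‿- (ℕ→ℚ 2))))))) ⟩
  toℚᵘ (ℕ→ℚ Q) ℚᵘ.+ toℚᵘ (ℕ→ℚ F) ℚᵘ.* (toℚᵘ (ℕ→ℚ T) ℚᵘ.- toℚᵘ (ℕ→ℚ 2))
    ≈⟨ ℚᵘ.+-cong (toℚᵘ-/ℚ (+ Q) 0)
         (ℚᵘ.*-cong (toℚᵘ-/ℚ (+ F) 0) (ℚᵘ.+-cong (toℚᵘ-/ℚ (+ T) 0) (ℚᵘ.-‿cong (toℚᵘ-/ℚ (+ 2) 0)))) ⟩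
  mkℚᵘ (+ Q) 0 ℚᵘ.+ mkℚᵘ (+ F) 0 ℚᵘ.* (mkℚᵘ (+ T) 0 ℚᵘ.- mkℚᵘ (+ 2) 0)
    ≈⟨ *≡* (normalise (+ Q) (+ F) (+ T)) ⟩
  mkℚᵘ (bracket Q F T) 0 ∎
  where
  open ℚᵘ.≃-Reasoning
  normalise : ∀ (q f t : ℤ) →
    (q ℤ.* + 1 ℤ.+ (f ℤ.* (t ℤ.* + 1 ℤ.+ (ℤ.- + 2) ℤ.* + 1)) ℤ.* + 1) ℤ.* + 1 ≡ (q ℤ.+ f ℤ.* (t ℤ.- + 2)) ℤ.* + 1
  normalise = ℤ-Solver.solve-∀

toℚᵘ-βform : ∀ N n d Q F T →
  toℚᵘ (βform N n (suc d) Q F T) ≃ mkℚᵘ (+ N ℤ.* + suc d ℤ.+ + n ℤ.* bracket Q F T) d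
toℚᵘ-βform N n d Q F T = begin
  toℚᵘ (βform N n (suc d) Q F T)
    ≈⟨ ℚᵘ.≃-trans (ℚ.toℚᵘ-homo-+ (ℕ→ℚ N) _) (ℚᵘ.+-congʳ (toℚᵘ (ℕ→ℚ N)) (ℚ.toℚᵘ-homo-* ((+ n) /ℚ suc d) _)) ⟩
  toℚᵘ (ℕ→ℚ N) ℚᵘ.+ toℚᵘ ((+ n) /ℚ suc d) ℚᵘ.* toℚᵘ (ℕ→ℚ Q ℚ.+ ℕ→ℚ F ℚ.* (ℕ→ℚ T ℚ.- ℕ→ℚ 2))
    ≈⟨ ℚᵘ.+-cong (toℚᵘ-/ℚ (+ N) 0) (ℚᵘ.*-cong (toℚᵘ-/ℚ (+ n) d) (toℚᵘ-bracket Q F T)) ⟩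
  mkℚᵘ (+ N) 0 ℚᵘ.+ mkℚᵘ (+ n) d ℚᵘ.* mkℚᵘ Z 0
    ≈⟨ ℚᵘ.+-congʳ (mkℚᵘ (+ N) 0) product ⟩
  mkℚᵘ (+ N) 0 ℚᵘ.+ mkℚᵘ (+ n ℤ.* Z) d
    ≈⟨ sum ⟩
  mkℚᵘ (+ N ℤ.* + suc d ℤ.+ + n ℤ.* Z) d ∎
  where
  open ℚᵘ.≃-Reasoning
  Z = bracket Q F T
  product : mkℚᵘ (+ n) d ℚᵘ.* mkℚᵘ Z 0 ≃ mkℚᵘ (+ n ℤ.* Z) d
  product = *≡* (cong (λ k → (+ n ℤ.* Z) ℤ.* + suc k) (sym (ℕ.*-identityʳ d)))
  sum : mkℚᵘ (+ N) 0 ℚᵘ.+ mkℚᵘ (+ n ℤ.* Z) d ≃ mkℚᵘ (+ N ℤ.* + suc d ℤ.+ + n ℤ.* Z) d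
  sum = *≡* (cong₂ (λ x k → (+ N ℤ.* + suc d ℤ.+ x) ℤ.* + suc k) (ℤ.*-identityʳ (+ n ℤ.* Z)) (sym (ℕ.+-identityʳ d)))

cross-multiply-< : ∀ (N : ℤ) n P (Ta Tb Za Zb : ℤ) → Zb ℤ.* Ta ℤ.< Za ℤ.* Tb →
  (N ℤ.* (+ suc P ℤ.* Tb) ℤ.+ + suc n ℤ.* Zb) ℤ.* (+ suc P ℤ.* Ta) ℤ.<
  (N ℤ.* (+ suc P ℤ.* Ta) ℤ.+ + suc n ℤ.* Za) ℤ.* (+ suc P ℤ.* Tb)
cross-multiply-< N n P Ta Tb Za Zb ZbTa<ZaTb =
  subst₂ ℤ._<_ (sym (expandˡ N (+ suc n) (+ suc P) Ta Tb Zb)) (sym (expandʳ N (+ suc n) (+ suc P) Ta Tb Za))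
    (ℤ.+-monoʳ-< (N ℤ.* (+ suc P ℤ.* Ta) ℤ.* (+ suc P ℤ.* Tb))
      (ℤ.*-monoˡ-<-pos (+ suc n ℤ.* + suc P) ZbTa<ZaTb))
  where
  expandˡ : ∀ N n P Ta Tb Z → (N ℤ.* (P ℤ.* Tb) ℤ.+ n ℤ.* Z) ℤ.* (P ℤ.* Ta)
                              ≡ N ℤ.* (P ℤ.* Ta) ℤ.* (P ℤ.* Tb) ℤ.+ n ℤ.* P ℤ.* (Z ℤ.* Ta)
  expandˡ = ℤ-Solver.solve-∀
  expandʳ : ∀ N n P Ta Tb Z → (N ℤ.* (P ℤ.* Ta) ℤ.+ n ℤ.* Z) ℤ.* (P ℤ.* Tb)
                              ≡ N ℤ.* (P ℤ.* Ta) ℤ.* (P ℤ.* Tb) ℤ.+ n ℤ.* P ℤ.* (Z ℤ.* Tb)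
  expandʳ = ℤ-Solver.solve-∀

βform-< : ∀ N n P Ta Tb Qa Qb Fa Fb → .{{NonZero n}} → .{{NonZero P}} → .{{NonZero Ta}} → .{{NonZero Tb}} →
  bracket Qb Fb Tb ℤ.* + Ta ℤ.< bracket Qa Fa Ta ℤ.* + Tb →
  βform N n (P * Tb) Qb Fb Tb ℚ.< βform N n (P * Ta) Qa Fa Ta
βform-< N (suc n) (suc P) (suc ta) (suc tb) Qa Qb Fa Fb Zb*Ta<Za*Tb = ℚ.toℚᵘ-cancel-< (begin-strict
  toℚᵘ (βform N (suc n) (suc P * suc tb) Qb Fb (suc tb)) ≃⟨ toℚᵘ-βform N (suc n) _ Qb Fb (suc tb) ⟩
  mkℚᵘ _ _  <⟨ *<* (cross-multiply-< (+ N) n P (+ suc ta) (+ suc tb) _ _ Zb*Ta<Za*Tb) ⟩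
  mkℚᵘ _ _  ≃⟨ toℚᵘ-βform N (suc n) _ Qa Fa (suc ta) ⟨
  toℚᵘ (βform N (suc n) (suc P * suc ta) Qa Fa (suc ta)) ∎)
  where open ℚᵘ.≤-Reasoning

-- Comparison of β_a and β_b

module _ {r} (p : Fin (2 + r) → ℕ) (primes : ∀ i → Prime (p i)) (incr : StrictlyIncreasing p)
         {a b : Fin (2 + r)} (a<b : a Fin.< b) where

  private
    instance
      p≢0 : ∀ {i} → NonZero (p i)
      p≢0 = prime⇒nonZero (primes _)

    a≢b = Fin.<⇒≢ a<b
    b′ = punchOut a≢b

    -- the primes other than p a and p b
    others : Fin r → ℕ
    others = p ∘ punchIn a ∘ punchIn b′

    R = ∏ others

  ∏≡pa*[pb*R] : ∏ p ≡ p a * (p b * R)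
  ∏≡pa*[pb*R] = begin
    ∏ p                                      ≡⟨ ∏-punchIn p a ⟩
    p a * ∏ (p ∘ punchIn a)                  ≡⟨ cong (p a *_) (∏-punchIn (p ∘ punchIn a) b′) ⟩
    p a * (p (punchIn a b′) * R)             ≡⟨ cong (λ i → p a * (p i * R)) (Fin.punchIn-punchOut a≢b) ⟩
    p a * (p b * R) ∎
    where open ≡-Reasoning

  ∏/pa≡pb*R : ∏ p div p a ≡ p b * R
  ∏/pa≡pb*R = trans (cong (_div p a) ∏≡pa*[pb*R]) (*-div-cancelˡ (p a) (p b * R))

  ∏/pb≡pa*R : ∏ p div p b ≡ p a * R
  ∏/pb≡pa*R = trans (cong (_div p b) (trans ∏≡pa*[pb*R] (x∙yz≈y∙xz (p a) (p b) R)))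
                    (*-div-cancelˡ (p b) (p a * R))

  private
    pa∤R : ¬ p a ∣ R
    pa∤R = prime∤∏ others (primes a) (primes ∘ _) (λ i → strictlyIncreasing⇒≢ incr (Fin.punchInᵢ≢i a _))

    pb∤R : ¬ p b ∣ R
    pb∤R = prime∤∏ others (primes b) (primes ∘ _)
      (λ i → strictlyIncreasing⇒≢ incr (λ eq → Fin.punchInᵢ≢i b′ i
        (Fin.punchIn-injective a _ _ (trans eq (sym (Fin.punchIn-punchOut a≢b))))))

  φ[∏/pa]≡[pb∸1]*φR : φ (∏ p div p a) ≡ (p b ∸ 1) * φ R
  φ[∏/pa]≡[pb∸1]*φR = trans (cong φ ∏/pa≡pb*R) (φ-*-prime R (primes b) pb∤R)

  φ[∏/pb]≡[pa∸1]*φR : φ (∏ p div p b) ≡ (p a ∸ 1) * φ R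
  φ[∏/pb]≡[pa∸1]*φR = trans (cong φ ∏/pb≡pa*R) (φ-*-prime R (primes a) pa∤R)

  R≤[1+r]*φR : R ≤ (1 + r) * φ R
  R≤[1+r]*φR = subst (_≤ (1 + r) * φ R) (ℕ.*-identityˡ R)
    (φ-∏-lowerBound others 0 (primes ∘ _) (strictlyIncreasing-punchIn b′ (strictlyIncreasing-punchIn a incr))
      (λ i → nonTrivial⇒n>1 _ {{prime⇒nonTrivial (primes _)}}))

  β-< : ∀ (e : Fin (2 + r) → ℕ) {X} → X ≤ p b ^ (e b ∸ 1) → 2 * φ (∏ p div p a) < ∏ p div p a →
    (1 + r) * p a ≤ X * (p b ∸ p a) + 2 * φ (p a) → β p e b (e b) ℚ.< β p e a (e a)
  β-< e {X} X≤Tb a-side hyp =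
    βform-< (φ n) n (∏ p) Ta Tb Qa Qb Fa Fb (bracket-cross-< {Qa} {Qb} {Fa} {Fb} {Ta} Tb b-side a-side)
    where
    n = nOf p e
    Ta = p a ^ (e a ∸ 1)
    Tb = p b ^ (e b ∸ 1)
    instance
      n≢0 : NonZero n
      n≢0 = ∏-nonZero (λ i → p i ^ e i) (λ i → ℕ.m^n≢0 (p i) (e i))
      ∏≢0 : NonZero (∏ p)
      ∏≢0 = ∏-nonZero p (λ _ → p≢0)
      Ta≢0 : NonZero Ta
      Ta≢0 = ℕ.m^n≢0 (p a) (e a ∸ 1)
      Tb≢0 : NonZero Tb
      Tb≢0 = ℕ.m^n≢0 (p b) (e b ∸ 1)
    Qa = ∏ p div p a
    Qb = ∏ p div p b
    Fa = φ Qa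
    Fb = φ Qb
    hk : (1 + r) * p a ≤ Tb * (p b ∸ p a) + 2 * (p a ∸ 1)
    hk = begin
      (1 + r) * p a                    ≤⟨ hyp ⟩
      X * (p b ∸ p a) + 2 * φ (p a)    ≤⟨ ℕ.+-monoˡ-≤ (2 * φ (p a)) (ℕ.*-monoˡ-≤ (p b ∸ p a) X≤Tb) ⟩
      Tb * (p b ∸ p a) + 2 * φ (p a)   ≡⟨ cong (λ x → Tb * (p b ∸ p a) + 2 * x) (φ-prime (primes a)) ⟩
      Tb * (p b ∸ p a) + 2 * (p a ∸ 1) ∎
      where open ℕ.≤-Reasoning
    b-side : Qb + Fb * Tb ≤ Fa * Tb + 2 * Fb
    b-side = subst₂ _≤_
      (cong₂ (λ Q F → Q + F * Tb) (sym ∏/pb≡pa*R) (sym φ[∏/pb]≡[pa∸1]*φR))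
      (cong₂ (λ G F → G * Tb + 2 * F) (sym φ[∏/pa]≡[pb∸1]*φR) (sym φ[∏/pb]≡[pa∸1]*φR))
      (b-bracket-bound {1 + r} {R} {φ R} {p a} {p b} {Tb}
        (>-nonZero⁻¹ (p a)) (ℕ.<⇒≤ (incr a b a<b)) R≤[1+r]*φR hk)

proposition3p6 :
    (r : ℕ) → 3 ≤ r →
    (p : Fin r → ℕ) → (e : Fin r → ℕ) →
    (∀ i → Prime (p i)) →
    (∀ i j → i Fin.< j → p i < p j) →
    (∀ i → 1 ≤ e i) →
    (a b : Fin r) → a Fin.< b →
    2 * φ (∏ p div p a) < ∏ p div p a →
    ((3 ≤ e b →
        (r ∸ 1) * p a ≤ p b ^ 2 * (p b ∸ p a) + 2 * φ (p a) →
        β p e b (e b) ℚ.< β p e a (e a))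
     × (e b ≡ 2 →
        (r ∸ 1) * p a ≤ p b * (p b ∸ p a) + 2 * φ (p a) →
        β p e b (e b) ℚ.< β p e a (e a)))
-- Only a < b (hence r ≥ 2) is needed: 3 ≤ r merely rules out r = 1, and n_i ≥ 1 is unused.
proposition3p6 (suc zero) (s≤s ()) _ _ _ _ _ _ _ _ _
proposition3p6 (suc (suc r)) _ p e primes incr _ a b a<b a-side =
    (λ 3≤eb → β-< p primes incr a<b e (ℕ.^-monoʳ-≤ (p b) (ℕ.∸-monoˡ-≤ 1 3≤eb)) a-side)
  , (λ eb≡2 → β-< p primes incr a<b e (ℕ.≤-reflexive (pb≡pb^[eb∸1] eb≡2)) a-side)
  where
  instance _ = prime⇒nonZero (primes b)
  pb≡pb^[eb∸1] : e b ≡ 2 → p b ≡ p b ^ (e b ∸ 1)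
  pb≡pb^[eb∸1] eb≡2 = trans (sym (ℕ.*-identityʳ (p b))) (cong (λ k → p b ^ (k ∸ 1)) (sym eb≡2))
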